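{- Let $\mathfrak{M}_1=\langle W_1,R_1,\{P_{k,1}\}_{k\in K}\rangle$ and $\mathfrak{M}_2=\langle W_2,R_2,\{P_{k,2}\}_{k\in K}\rangle$ be Kripke models, $w_1\in W_1$, $w_2\in W_2$, and let $\Lambda\subseteq\{\smile,\frown\}$. Then there is a $\Lambda$-simulation $S$ on the disjoint union $\mathfrak{M}_1\uplus\mathfrak{M}_2$ with $((1,w_1),(2,w_2))\in S$ if and only if there is a directed $\Lambda$-simulation $(F,B)$ between $\mathfrak{M}_1$ and $\mathfrak{M}_2$ with $(w_1,w_2)\in F$.
   Context: Fix a set $K$. A Kripke model is $\mathfrak{M}=\langle W,R,\{P_k\}_{k\in K}\rangle$ with $W$ a nonempty set, $R\subseteq W\times W$, each $P_k\subseteq W$. The disjoint union $\mathfrak{M}_1\uplus\mathfrak{M}_2$ has worlds $W=\{(\ell,w):\ell\in\{1,2\},w\in W_\ell\}$, accessibility $R=\{((\ell,w),(\ell,v)):\ell\in\{1,2\},(w,v)\in R_\ell\}$ and $P_k=\{(\ell,w):w\in P_{k,\ell}\}$. For a Kripke model $\langle W,R,\{P_k\}\rangle$ and $\Lambda\subseteq\{\smile,\frown\}$, a $\Lambda$-simulation on it is a relation $S\subseteq W\times W$ such that: for every $k$, if $(w,v)\in S$ and $w\in P_k$ then $v\in P_k$; if $\smile\in\Lambda$: whenever $(w,v)\in S$ and $wRs$ there is $t$ with $vRt$ and $(t,s)\in S$; if $\frown\in\Lambda$: whenever $(w,v)\in S$ and $vRt$ there is $s$ with $wRs$ and $(t,s)\in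 S$. A directed $\Lambda$-simulation between $\mathfrak{M}_1$ and $\mathfrak{M}_2$ is a pair $(F,B)$ with $F\subseteq W_1\times W_2$, $B\subseteq W_2\times W_1$ such that for all $k\in K$: (F$_k$) if $(w_1,w_2)\in F$ and $w_1\in P_{k,1}$ then $w_2\in P_{k,2}$; (B$_k$) if $(w_2,w_1)\in B$ and $w_2\in P_{k,2}$ then $w_1\in P_{k,1}$; and if $\smile\in\Lambda$: (F$\smile$) if $(w_1,w_2)\in F$ and $w_1R_1v_1$ then there is $t_2$ with $w_2R_2t_2$ and $(t_2,v_1)\in B$; (B$\smile$) if $(w_2,w_1)\in B$ and $w_2R_2v_2$ then there is $t_1$ with $w_1R_1t_1$ and $(t_1,v_2)\in F$; and if $\frown\in\Lambda$: (F$\frown$) if $(w_1,w_2)\in F$ and $w_2R_2v_2$ then there is $t_1$ with $w_1R_1t_1$ and $(v_2,t_1)\in B$; (B$\frown$) if $(w_2,w_1)\in B$ and $w_1R_1v_1$ then there is $t_2$ with $w_2R_2t_2$ and $(v_1,t_2)\in F$. -}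

module Defs where

open import Level using (Level; _⊔_; suc; 0ℓ)
open import Data.Bool using (Bool; true; false; T)
open import Data.Product using (Σ; ∃; _×_; _,_)
open import Data.Sum using (_⊎_; inj₁; inj₂)

record KripkeModel (K : Set) : Set₁ where
  field
    W : Set
    R : W → W → Set
    P : K → W → Set

open KripkeModel public

-- Λ ⊆ {⌣ , ⌢}, represented by its characteristic function.
record Lambda : Set where
  field
    hasSmile : Bool
    hasFrown : Bool

open Lambda public

-- Disjoint union: worlds (1,w) = inj₁ w, (2,w) = inj₂ w.
data UR {K : Set} (M₁ M₂ : KripkeModel K) : W M₁ ⊎ W M₂ → W M₁ ⊎ W M₂ → Set where
  r₁ : ∀ {w v} → R M₁ w v → UR M₁ M₂ (inj₁ w) (inj₁ v)
  r₂ : ∀ {w v} → R M₂ w v → UR M₁ M₂ (inj₂ w) (inj₂ v)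

UP : {K : Set} (M₁ M₂ : KripkeModel K) → K → W M₁ ⊎ W M₂ → Set
UP M₁ M₂ k (inj₁ w) = P M₁ k w
UP M₁ M₂ k (inj₂ w) = P M₂ k w

_⊎ᴷ_ : {K : Set} → KripkeModel K → KripkeModel K → KripkeModel K
M₁ ⊎ᴷ M₂ = record { W = W M₁ ⊎ W M₂ ; R = UR M₁ M₂ ; P = UP M₁ M₂ }

record IsSimulation {K : Set} (Λ : Lambda) (M : KripkeModel K)
                    (S : W M → W M → Set) : Set where
  field
    atoms : ∀ k w v → S w v → P M k w → P M k v
    smile : T (hasSmile Λ) → ∀ w v s → S w v → R M w s →
            Σ (W M) λ t → R M v t × S t s
    frown : T (hasFrown Λ) → ∀ w v t → S w v → R M v t →
            Σ (W M) λ s → R M w s × S t s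

record IsDirectedSimulation {K : Set} (Λ : Lambda) (M₁ M₂ : KripkeModel K)
         (F : W M₁ → W M₂ → Set) (B : W M₂ → W M₁ → Set) : Set where
  field
    Fk : ∀ k w₁ w₂ → F w₁ w₂ → P M₁ k w₁ → P M₂ k w₂
    Bk : ∀ k w₂ w₁ → B w₂ w₁ → P M₂ k w₂ → P M₁ k w₁
    F⌣ : T (hasSmile Λ) → ∀ w₁ w₂ v₁ → F w₁ w₂ → R M₁ w₁ v₁ →
         Σ (W M₂) λ t₂ → R M₂ w₂ t₂ × B t₂ v₁
    B⌣ : T (hasSmile Λ) → ∀ w₂ w₁ v₂ → B w₂ w₁ → R M₂ w₂ v₂ →
         Σ (W M₁) λ t₁ → R M₁ w₁ t₁ × F t₁ v₂
    F⌢ : T (hasFrown Λ) → ∀ w₁ w₂ v₂ → F w₁ w₂ → R M₂ w₂ v₂ →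
         Σ (W M₁) λ t₁ → R M₁ w₁ t₁ × B v₂ t₁
    B⌢ : T (hasFrown Λ) → ∀ w₂ w₁ v₁ → B w₂ w₁ → R M₁ w₁ v₁ →
         Σ (W M₂) λ t₂ → R M₂ w₂ t₂ × F v₁ t₂

{-# OPTIONS --safe #-}
-- Accessibility in the disjoint union never leaves a summand, so every clause of a simulation
-- on M₁ ⊎ M₂ at a pair ((1,w₁),(2,w₂)) or ((2,w₂),(1,w₁)) only involves pairs that again cross
-- between the summands. Hence the two crossing parts of a simulation form a directed simulation,
-- and conversely a directed simulation (F, B), extended by the empty relation on same-side
-- pairs, is a simulation on the union.
module Submission where

open import Data.Empty using (⊥)
open import Data.Product using (Σ; Σ-syntax; _×_; _,_)
open import Data.Sum using (_⊎_; inj₁; inj₂)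
open import Function.Bundles using (_⇔_; mk⇔; Equivalence)

open import Defs

open Equivalence using (to; from)

module _ {K : Set} (M₁ M₂ : KripkeModel K) where

  ⊎ᴷ-successors₁ : ∀ {w} (Q : W M₁ ⊎ W M₂ → Set) →
    (Σ[ t ∈ W M₁ ⊎ W M₂ ] UR M₁ M₂ (inj₁ w) t × Q t) ⇔ (Σ[ v ∈ W M₁ ] R M₁ w v × Q (inj₁ v))
  ⊎ᴷ-successors₁ Q = mk⇔ (λ { (inj₁ v , r₁ r , q) → v , r , q }) (λ (v , r , q) → inj₁ v , r₁ r , q)

  ⊎ᴷ-successors₂ : ∀ {w} (Q : W M₁ ⊎ W M₂ → Set) →
    (Σ[ t ∈ W M₁ ⊎ W M₂ ] UR M₁ M₂ (inj₂ w) t × Q t) ⇔ (Σ[ v ∈ W M₂ ] R M₂ w v × Q (inj₂ v))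
  ⊎ᴷ-successors₂ Q = mk⇔ (λ { (inj₂ v , r₂ r , q) → v , r , q }) (λ (v , r , q) → inj₂ v , r₂ r , q)

  crossRel : (W M₁ → W M₂ → Set) → (W M₂ → W M₁ → Set) → W M₁ ⊎ W M₂ → W M₁ ⊎ W M₂ → Set
  crossRel F B (inj₁ w₁) (inj₂ w₂) = F w₁ w₂
  crossRel F B (inj₂ w₂) (inj₁ w₁) = B w₂ w₁
  crossRel F B _         _         = ⊥

  module _ {Λ : Lambda} where

    IsSimulation⇒IsDirectedSimulation : {S : W M₁ ⊎ W M₂ → W M₁ ⊎ W M₂ → Set} →
      IsSimulation Λ (M₁ ⊎ᴷ M₂) S →
      IsDirectedSimulation Λ M₁ M₂ (λ w₁ w₂ → S (inj₁ w₁) (inj₂ w₂)) (λ w₂ w₁ → S (inj₂ w₂) (inj₁ w₁))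
    IsSimulation⇒IsDirectedSimulation sim = record
      { Fk = λ k w₁ w₂ → atoms k (inj₁ w₁) (inj₂ w₂)
      ; Bk = λ k w₂ w₁ → atoms k (inj₂ w₂) (inj₁ w₁)
      ; F⌣ = λ h w₁ w₂ v₁ s r → to (⊎ᴷ-successors₂ _) (smile h (inj₁ w₁) (inj₂ w₂) (inj₁ v₁) s (r₁ r))
      ; B⌣ = λ h w₂ w₁ v₂ s r → to (⊎ᴷ-successors₁ _) (smile h (inj₂ w₂) (inj₁ w₁) (inj₂ v₂) s (r₂ r))
      ; F⌢ = λ h w₁ w₂ v₂ s r → to (⊎ᴷ-successors₁ _) (frown h (inj₁ w₁) (inj₂ w₂) (inj₂ v₂) s (r₂ r))
      ; B⌢ = λ h w₂ w₁ v₁ s r → to (⊎ᴷ-successors₂ _) (frown h (inj₂ w₂) (inj₁ w₁) (inj₁ v₁) s (r₁ r))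
      }
      where open IsSimulation sim

    IsDirectedSimulation⇒IsSimulation : {F : W M₁ → W M₂ → Set} {B : W M₂ → W M₁ → Set} →
      IsDirectedSimulation Λ M₁ M₂ F B → IsSimulation Λ (M₁ ⊎ᴷ M₂) (crossRel F B)
    IsSimulation.atoms (IsDirectedSimulation⇒IsSimulation d) k (inj₁ w₁) (inj₂ w₂) =
      IsDirectedSimulation.Fk d k w₁ w₂
    IsSimulation.atoms (IsDirectedSimulation⇒IsSimulation d) k (inj₂ w₂) (inj₁ w₁) =
      IsDirectedSimulation.Bk d k w₂ w₁
    IsSimulation.smile (IsDirectedSimulation⇒IsSimulation d) h (inj₁ w₁) (inj₂ w₂) (inj₁ v₁) f (r₁ r) =
      from (⊎ᴷ-successors₂ _) (IsDirectedSimulation.F⌣ d h w₁ w₂ v₁ f r)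
    IsSimulation.smile (IsDirectedSimulation⇒IsSimulation d) h (inj₂ w₂) (inj₁ w₁) (inj₂ v₂) b (r₂ r) =
      from (⊎ᴷ-successors₁ _) (IsDirectedSimulation.B⌣ d h w₂ w₁ v₂ b r)
    IsSimulation.frown (IsDirectedSimulation⇒IsSimulation d) h (inj₁ w₁) (inj₂ w₂) (inj₂ v₂) f (r₂ r) =
      from (⊎ᴷ-successors₁ _) (IsDirectedSimulation.F⌢ d h w₁ w₂ v₂ f r)
    IsSimulation.frown (IsDirectedSimulation⇒IsSimulation d) h (inj₂ w₂) (inj₁ w₁) (inj₁ v₁) b (r₁ r) =
      from (⊎ᴷ-successors₂ _) (IsDirectedSimulation.B⌢ d h w₂ w₁ v₁ b r)

proposition5p5 : {K : Set} (M₁ M₂ : KripkeModel K) (w₁ : W M₁) (w₂ : W M₂) (Λ : Lambda) →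
    (Σ (W (M₁ ⊎ᴷ M₂) → W (M₁ ⊎ᴷ M₂) → Set) λ S →
        IsSimulation Λ (M₁ ⊎ᴷ M₂) S × S (inj₁ w₁) (inj₂ w₂))
    ⇔
    (Σ (W M₁ → W M₂ → Set) λ F → Σ (W M₂ → W M₁ → Set) λ B →
        IsDirectedSimulation Λ M₁ M₂ F B × F w₁ w₂)
proposition5p5 M₁ M₂ w₁ w₂ Λ = mk⇔
  (λ (S , sim , s) → _ , _ , IsSimulation⇒IsDirectedSimulation M₁ M₂ sim , s)
  (λ (F , B , d , f) → crossRel M₁ M₂ F B , IsDirectedSimulation⇒IsSimulation M₁ M₂ d , f)
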